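{- Let $\pi$ be a permutation of size $n$, let $\mathcal{D}_1,\dots,\mathcal{D}_n$ be sets of permutations, let $\gamma$ be a permutation, and let $\{\alpha_1,\dots,\alpha_\ell\}$ be the set of embeddings of $\gamma$ in $\pi$. Then $$\pi[\mathcal{D}_1,\dots,\mathcal{D}_n](\gamma)=\bigcup_{i=1}^{\ell}\pi[\mathcal{D}_1(\gamma_{\alpha_i(1)}),\mathcal{D}_2(\gamma_{\alpha_i(2)}),\dots,\mathcal{D}_n(\gamma_{\alpha_i(n)})].$$
   Context: $\varepsilon$ is the empty permutation. For $\gamma$ of size $p$ and $I=\{i_1<\dots<i_k\}\subseteq\{1,\dots,p\}$, $\gamma_I$ is the permutation order-isomorphic to $\gamma_{i_1}\cdots\gamma_{i_k}$ ($\gamma_\emptyset=\varepsilon$). $\sigma$ contains $\tau$ if $\sigma_I=\tau$ for some $I$. An interval of $\gamma$ is a nonempty set of consecutive indices whose values are consecutive integers. Substitution $\sigma[\pi^1,\dots,\pi^n]$: the $i$-th entry of $\sigma$ is replaced by a block of consecutive values order-isomorphic to $\pi^i$, blocks ordered by value as in $\sigma$. Generalized substitution $\sigma\{\pi^1,\dots,\pi^n\}$ (some $\pi^i$ possibly $\varepsilon$) is $\sigma_J[\pi^{j}:j\in J]$ with $J=\{i:\pi^i\neq\varepsilon\}$ in increasing order ($\varepsilon$ if $J=\emptyset$). An embedding of $\gamma$ (size $p$) in $\pi$ (size $n$) is a map $\alpha$ from $\{1,\dots,n\}$ to the set of intervals of $\gamma$ together with $\emptyset$, such that the word $\alpha(1)\cdots\alpha(n)$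 (each interval read as its increasing list of indices) equals $1\,2\cdots p$, and $\pi\{\gamma_{\alpha(1)},\dots,\gamma_{\alpha(n)}\}=\gamma$. For sets of permutations, $\pi[\mathcal{D}_1,\dots,\mathcal{D}_n]=\{\pi[\sigma_1,\dots,\sigma_n]:\sigma_i\in\mathcal{D}_i\}$, and $\mathcal{A}(\tau)$ is the set of elements of $\mathcal{A}$ containing $\tau$; in particular $\mathcal{A}(\varepsilon)=\mathcal{A}$. -}

module Defs where

open import Data.Nat using (ℕ; zero; suc; _+_; _<ᵇ_; _≤_)
open import Data.Bool using (if_then_else_)
open import Data.List using (List; []; _∷_; length; map; concat; zipWith; upTo; _++_)
open import Data.List.Relation.Unary.All using (All)
open import Data.List.Relation.Unary.Linked using (Linked)
open import Data.Unit using (⊤)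
open import Data.Empty using (⊥)
open import Data.List.Relation.Binary.Permutation.Propositional using (_↭_)
open import Data.Product using (Σ; ∃; _×_)
open import Data.Sum using (_⊎_)
open import Relation.Binary.PropositionalEquality using (_≡_)
open import Data.Nat using (_<_)

-- Convention: a permutation of size n is a list of the values 0,…,n-1
-- (0-based values), and indices are 0-based as well.

IsPerm : List ℕ → Set
IsPerm xs = xs ↭ upTo (length xs)

ε : List ℕ
ε = []

rank : ℕ → List ℕ → ℕ
rank x [] = 0
rank x (y ∷ ys) = if y <ᵇ x then suc (rank x ys) else rank x ys

std : List ℕ → List ℕ
std xs = map (λ x → rank x xs) xs

-- entry at index i (default 0 out of range; only used in range)
at : List ℕ → ℕ → ℕ
at [] _ = 0
at (x ∷ xs) zero = x
at (x ∷ xs) (suc i) = at xs i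

-- γ_I for I given as the increasing list of its indices
patt : List ℕ → List ℕ → List ℕ
patt γ I = std (map (at γ) I)

Contains : List ℕ → List ℕ → Set
Contains σ τ = ∃ λ (I : List ℕ) → Linked _<_ I × All (_< length σ) I × patt σ I ≡ τ

offset : ℕ → List ℕ → List (List ℕ) → ℕ
offset v (p ∷ ps) (s ∷ ss) = (if p <ᵇ v then length s else 0) + offset v ps ss
offset v _ _ = 0

subst : List ℕ → List (List ℕ) → List ℕ
subst σ πs = concat (zipWith (λ p s → map (offset p σ πs +_) s) σ πs)

nonEmptyIdx : ℕ → List (List ℕ) → List ℕ
nonEmptyIdx k [] = []
nonEmptyIdx k ([] ∷ ps) = nonEmptyIdx (suc k) ps
nonEmptyIdx k ((_ ∷ _) ∷ ps) = k ∷ nonEmptyIdx (suc k) ps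

dropEmpty : List (List ℕ) → List (List ℕ)
dropEmpty [] = []
dropEmpty ([] ∷ ps) = dropEmpty ps
dropEmpty ((x ∷ xs) ∷ ps) = (x ∷ xs) ∷ dropEmpty ps

gsubst : List ℕ → List (List ℕ) → List ℕ
gsubst σ πs = subst (patt σ (nonEmptyIdx 0 πs)) (dropEmpty πs)

IsInterval : List ℕ → List ℕ → Set
IsInterval γ I = Σ ℕ λ a → Σ ℕ λ k →
  (I ≡ map (a +_) (upTo (suc k))) × (a + suc k ≤ length γ) ×
  (∃ λ m → map (at γ) I ↭ map (m +_) (upTo (suc k)))

-- α (the list α(1),…,α(n), each an index list) is an embedding of γ in π
IsEmbedding : List ℕ → List ℕ → List (List ℕ) → Set
IsEmbedding γ π α =
  (length α ≡ length π) ×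
  All (λ I → I ≡ [] ⊎ IsInterval γ I) α ×
  (concat α ≡ upTo (length γ)) ×
  (gsubst π (map (patt γ) α) ≡ γ)

PSet : Set₁
PSet = List ℕ → Set

Members : List PSet → List (List ℕ) → Set
Members [] [] = ⊤
Members (D ∷ Ds) (σ ∷ σs) = D σ × Members Ds σs
Members _ _ = ⊥

InSubstSet : List ℕ → List PSet → List ℕ → Set
InSubstSet π Ds τ = ∃ λ (σs : List (List ℕ)) → Members Ds σs × τ ≡ subst π σs

restrict : PSet → List ℕ → PSet
restrict A τ σ = A σ × Contains σ τ

module Submission where

-- The heart of the proof is `pattern-of-subst`: if τ = π[σ₁,…,σₙ] and an index
-- set of τ is cut into the parts Kᵢ falling into the blocks σᵢ, then the
-- pattern of τ there is π[(σ₁)_{K₁},…,(σₙ)_{Kₙ}].  It is proved by computing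
-- the rank of every value read (`std-layout`).  The two directions follow:
--   (⇒) cut the occurrence of γ blockwise (`split-blocks`), so γ = π[ρs] with
--       ρᵢ ⊆ σᵢ; the blocks of γ then form the `canonical-embedding` α of γ in
--       π, with γ_{α(i)} = ρᵢ;
--   (⇐) join the occurrences of the γ_{α(i)} in the σᵢ (`join-indexSets`); by
--       `pattern-of-subst` their pattern is π[γ_{α(1)},…] = π{γ_{α(1)},…} = γ,
--       where generalized and ordinary substitution agree (`gsubst≡subst`).

open import Defs
open import Data.Nat using (ℕ; zero; suc; _+_; _∸_; _≤_; _<_; _<ᵇ_; z≤n; s≤s; _<?_)
open import Data.Nat.Properties
open import Data.Nat.ListAction using (sum)
open import Data.Bool using (true; false; if_then_else_)
open import Data.List using (List; []; _∷_; length; map; concat; zipWith; upTo; applyUpTo; _++_)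
open import Data.List.Properties using (map-upTo; length-map; length-++; map-++; map-∘; map-cong; map-cong-local; map-id-local; map-id; ++-assoc)
open import Data.List.Relation.Unary.All using (All; []; _∷_)
import Data.List.Relation.Unary.All as All
import Data.List.Relation.Unary.All.Properties as All
open import Data.List.Relation.Unary.AllPairs using (AllPairs; []; _∷_)
import Data.List.Relation.Unary.AllPairs as AllPairs
import Data.List.Relation.Unary.AllPairs.Properties as AllPairs
open import Data.List.Relation.Unary.Linked using (Linked; [-]; _∷_)
import Data.List.Relation.Unary.Linked as Linked
open import Data.List.Relation.Unary.Linked.Properties using (Linked⇒All; Linked⇒AllPairs; AllPairs⇒Linked)
open import Data.List.Relation.Unary.Unique.Propositional using (Unique)
open import Data.List.Relation.Unary.Unique.Propositional.Properties using (upTo⁺)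
open import Data.List.Membership.Propositional using (_∈_)
open import Data.List.Membership.Propositional.Properties using (∈-upTo⁻; ∈-map⁺)
open import Data.List.Relation.Unary.Any using (here; there)
open import Data.List.Relation.Binary.Permutation.Propositional as ↭ using (_↭_; ↭-sym; ↭⇒↭ₛ)
import Data.List.Relation.Binary.Permutation.Propositional.Properties as ↭
import Data.List.Relation.Binary.Permutation.Setoid.Properties as ↭ₛ
open import Data.List.Relation.Binary.Pointwise using (Pointwise; []; _∷_)
import Data.List.Relation.Binary.Pointwise as PW
import Data.List.Sort
open import Data.Product using (Σ; ∃; _×_; _,_; proj₁; proj₂)
open import Data.Sum using (_⊎_; inj₁; inj₂)
open import Data.Empty using (⊥-elim)
open import Data.Unit using (tt)
open import Function.Bundles using (_⇔_; mk⇔)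
open import Relation.Nullary using (yes; no)
open import Relation.Binary.PropositionalEquality
  using (_≡_; _≢_; refl; sym; trans; cong; cong₂; setoid; module ≡-Reasoning) renaming (subst to ≡-subst)
open ≡-Reasoning

<ᵇ-true : ∀ {m n} → m < n → (m <ᵇ n) ≡ true
<ᵇ-true {zero} {suc n} _ = refl
<ᵇ-true {suc m} {suc n} (s≤s m<n) = <ᵇ-true m<n

<ᵇ-false : ∀ {m n} → n ≤ m → (m <ᵇ n) ≡ false
<ᵇ-false {m} {zero} _ = refl
<ᵇ-false {suc m} {suc n} (s≤s n≤m) = <ᵇ-false n≤m

<ᵇ-true⁻ : ∀ m n → (m <ᵇ n) ≡ true → m < n
<ᵇ-true⁻ zero (suc n) _ = s≤s z≤n
<ᵇ-true⁻ (suc m) (suc n) e = s≤s (<ᵇ-true⁻ m n e)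

<ᵇ-false⁻ : ∀ m n → (m <ᵇ n) ≡ false → n ≤ m
<ᵇ-false⁻ m zero _ = z≤n
<ᵇ-false⁻ (suc m) (suc n) e = s≤s (<ᵇ-false⁻ m n e)
<ᵇ-false⁻ zero (suc n) ()

<ᵇ-+ : ∀ c y x → (c + y <ᵇ c + x) ≡ (y <ᵇ x)
<ᵇ-+ zero y x = refl
<ᵇ-+ (suc c) y x = <ᵇ-+ c y x

All-upTo : ∀ n → All (_< n) (upTo n)
All-upTo n = All.tabulate ∈-upTo⁻

perm-bounded : ∀ {xs} → IsPerm xs → All (_< length xs) xs
perm-bounded {xs} p = ↭.All-resp-↭ (↭-sym p) (All-upTo (length xs))

unique-resp-↭ : ∀ {xs ys} → xs ↭ ys → Unique xs → Unique ys
unique-resp-↭ p = ↭ₛ.Unique-resp-↭ (setoid ℕ) (↭⇒↭ₛ p)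

perm-unique : ∀ {xs} → IsPerm xs → Unique xs
perm-unique {xs} p = unique-resp-↭ (↭-sym p) (upTo⁺ (length xs))

rank-++ : ∀ x xs ys → rank x (xs ++ ys) ≡ rank x xs + rank x ys
rank-++ x [] ys = refl
rank-++ x (y ∷ xs) ys with y <ᵇ x
... | true = cong suc (rank-++ x xs ys)
... | false = rank-++ x xs ys

rank-↭ : ∀ x {xs ys} → xs ↭ ys → rank x xs ≡ rank x ys
rank-↭ x ↭.refl = refl
rank-↭ x (↭.prep y p) with y <ᵇ x
... | true = cong suc (rank-↭ x p)
... | false = rank-↭ x p
rank-↭ x (↭.swap y z p) with y <ᵇ x | z <ᵇ x
... | true | true = cong (λ k → suc (suc k)) (rank-↭ x p)
... | true | false = cong suc (rank-↭ x p)
... | false | true = cong suc (rank-↭ x p)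
... | false | false = rank-↭ x p
rank-↭ x (↭.trans p q) = trans (rank-↭ x p) (rank-↭ x q)

rank-shift : ∀ c x xs → rank (c + x) (map (c +_) xs) ≡ rank x xs
rank-shift c x [] = refl
rank-shift c x (y ∷ xs) rewrite <ᵇ-+ c y x with y <ᵇ x
... | true = cong suc (rank-shift c x xs)
... | false = rank-shift c x xs

rank-above : ∀ x xs → All (_< x) xs → rank x xs ≡ length xs
rank-above x [] [] = refl
rank-above x (y ∷ xs) (y<x ∷ ys<x) rewrite <ᵇ-true y<x = cong suc (rank-above x xs ys<x)

rank-below : ∀ x xs → All (x ≤_) xs → rank x xs ≡ 0
rank-below x [] [] = refl
rank-below x (y ∷ xs) (x≤y ∷ x≤ys) rewrite <ᵇ-false x≤y = rank-below x xs x≤ys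

rank-mono : ∀ {a b} xs → a ≤ b → rank a xs ≤ rank b xs
rank-mono [] _ = z≤n
rank-mono {a} {b} (y ∷ xs) a≤b with y <ᵇ a in y<ᵇa
... | true rewrite <ᵇ-true (<-≤-trans (<ᵇ-true⁻ y a y<ᵇa) a≤b) = s≤s (rank-mono xs a≤b)
... | false with y <ᵇ b
...   | true = m≤n⇒m≤1+n (rank-mono xs a≤b)
...   | false = rank-mono xs a≤b

rank-strict : ∀ {a b} xs → a < b → a ∈ xs → rank a xs < rank b xs
rank-strict {a} {b} (a ∷ xs) a<b (here refl)
  rewrite <ᵇ-false (≤-refl {a}) | <ᵇ-true a<b = s≤s (rank-mono xs (<⇒≤ a<b))
rank-strict {a} {b} (y ∷ xs) a<b (there a∈xs) with y <ᵇ a in y<ᵇa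
... | true rewrite <ᵇ-true (<-trans (<ᵇ-true⁻ y a y<ᵇa) a<b) = s≤s (rank-strict xs a<b a∈xs)
... | false with y <ᵇ b
...   | true = m≤n⇒m≤1+n (rank-strict xs a<b a∈xs)
...   | false = rank-strict xs a<b a∈xs

rank-<ᵇ : ∀ xs {p v} → p ∈ xs → v ∈ xs → (rank p xs <ᵇ rank v xs) ≡ (p <ᵇ v)
rank-<ᵇ xs {p} {v} p∈xs v∈xs with p <ᵇ v in p<ᵇv
... | true = <ᵇ-true (rank-strict xs (<ᵇ-true⁻ p v p<ᵇv) p∈xs)
... | false = <ᵇ-false (rank-mono xs (<ᵇ-false⁻ p v p<ᵇv))

rank-upTo : ∀ n x → x ≤ n → rank x (upTo n) ≡ x
rank-upTo zero zero z≤n = refl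
rank-upTo (suc n) zero _ rewrite sym (map-upTo suc n) =
  rank-below 0 (map suc (upTo n)) (All.tabulate (λ _ → z≤n))
rank-upTo (suc n) (suc x) (s≤s x≤n) rewrite sym (map-upTo suc n) =
  cong suc (trans (rank-shift 1 x (upTo n)) (rank-upTo n x x≤n))

std-perm : ∀ {xs} → IsPerm xs → std xs ≡ xs
std-perm {xs} p = map-id-local
  (All.map (λ {x} x<n → trans (rank-↭ x p) (rank-upTo (length xs) x (<⇒≤ x<n))) (perm-bounded p))

std-shift : ∀ c xs → std (map (c +_) xs) ≡ std xs
std-shift c xs = trans (sym (map-∘ xs)) (map-cong (λ x → rank-shift c x xs) xs)

length-std : ∀ xs → length (std xs) ≡ length xs
length-std xs = length-map _ xs

module Sort = Data.List.Sort ≤-decTotalOrder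

head-below : ∀ {y ys} → Linked _≤_ (y ∷ ys) → All (y ≤_) ys
head-below [-] = []
head-below (y≤z ∷ rest) = Linked⇒All ≤-trans y≤z rest

rank-sorted : ∀ s → Linked _≤_ s → Unique s → map (λ x → rank x s) s ≡ upTo (length s)
rank-sorted [] _ _ = refl
rank-sorted (y ∷ ys) sorted (y∉ys ∷ unique) rewrite <ᵇ-false (≤-refl {y}) =
  cong₂ _∷_ (rank-below y ys y≤ys) (begin
    map (λ x → rank x (y ∷ ys)) ys        ≡⟨ map-cong-local (All.zipWith y<z⇒rank-suc (y≤ys , y∉ys)) ⟩
    map (λ x → suc (rank x ys)) ys        ≡⟨ map-∘ ys ⟩
    map suc (map (λ x → rank x ys) ys)    ≡⟨ cong (map suc) (rank-sorted ys (Linked.tail sorted) unique) ⟩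
    map suc (upTo (length ys))            ≡⟨ map-upTo suc (length ys) ⟩
    applyUpTo suc (length ys)             ∎)
  where
  y≤ys : All (y ≤_) ys
  y≤ys = head-below sorted
  y<z⇒rank-suc : ∀ {z} → y ≤ z × y ≢ z → rank z (y ∷ ys) ≡ suc (rank z ys)
  y<z⇒rank-suc (y≤z , y≢z) rewrite <ᵇ-true (≤∧≢⇒< y≤z y≢z) = refl

-- Sorting changes no rank, and the ranks in the sorted list are 0,…,n-1.
std-unique : ∀ xs → Unique xs → IsPerm (std xs)
std-unique xs u = ≡-subst (λ l → std xs ↭ upTo l) (sym (length-std xs)) (↭.↭-trans
  (↭.map⁺ (λ x → rank x xs) (↭-sym (Sort.sort-↭ xs)))
  (↭.↭-reflexive (trans
    (map-cong (λ x → rank-↭ x (↭-sym (Sort.sort-↭ xs))) (Sort.sort xs))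
    (trans (rank-sorted (Sort.sort xs) (Sort.sort-↗ xs) (unique-resp-↭ (↭-sym (Sort.sort-↭ xs)) u))
           (cong upTo (↭.↭-length (Sort.sort-↭ xs)))))))

at-∈ : ∀ xs k → k < length xs → at xs k ∈ xs
at-∈ (x ∷ xs) zero _ = here refl
at-∈ (x ∷ xs) (suc k) (s≤s k<n) = there (at-∈ xs k k<n)

at-bounded : ∀ {s} k → IsPerm s → k < length s → at s k < length s
at-bounded {s} k p k<n = All.lookup (perm-bounded p) (at-∈ s k k<n)

at-injective : ∀ s i j → Unique s → i < length s → j < length s → at s i ≡ at s j → i ≡ j
at-injective (x ∷ s) zero zero _ _ _ _ = refl
at-injective (x ∷ s) zero (suc j) (x∉s ∷ _) _ (s≤s j<n) e = ⊥-elim (All.lookup x∉s (at-∈ s j j<n) e)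
at-injective (x ∷ s) (suc i) zero (x∉s ∷ _) (s≤s i<n) _ e = ⊥-elim (All.lookup x∉s (at-∈ s i i<n) (sym e))
at-injective (x ∷ s) (suc i) (suc j) (_ ∷ u) (s≤s i<n) (s≤s j<n) e = cong suc (at-injective s i j u i<n j<n e)

unique-at : ∀ s K → Unique s → AllPairs _<_ K → All (_< length s) K → Unique (map (at s) K)
unique-at s [] u _ _ = []
unique-at s (k ∷ K) u (k<K ∷ incr) (k<n ∷ K<n) = head-fresh k<K K<n ∷ unique-at s K u incr K<n
  where
  head-fresh : ∀ {K} → All (k <_) K → All (_< length s) K → All (at s k ≢_) (map (at s) K)
  head-fresh [] [] = []
  head-fresh (k<j ∷ k<K) (j<n ∷ K<n) =
    (λ e → <⇒≢ k<j (at-injective s _ _ u k<n j<n e)) ∷ head-fresh k<K K<n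

at-++ˡ : ∀ xs ys k → k < length xs → at (xs ++ ys) k ≡ at xs k
at-++ˡ (x ∷ xs) ys zero _ = refl
at-++ˡ (x ∷ xs) ys (suc k) (s≤s k<n) = at-++ˡ xs ys k k<n

at-++ʳ : ∀ xs ys k → at (xs ++ ys) (length xs + k) ≡ at ys k
at-++ʳ [] ys k = refl
at-++ʳ (x ∷ xs) ys k = at-++ʳ xs ys k

at-map : ∀ (f : ℕ → ℕ) xs k → k < length xs → at (map f xs) k ≡ f (at xs k)
at-map f (x ∷ xs) zero _ = refl
at-map f (x ∷ xs) (suc k) (s≤s k<n) = at-map f xs k k<n

map-at-upTo : ∀ xs → map (at xs) (upTo (length xs)) ≡ xs
map-at-upTo [] = refl
map-at-upTo (x ∷ xs) = cong (x ∷_) (begin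
  map (at (x ∷ xs)) (applyUpTo suc (length xs))  ≡⟨ cong (map (at (x ∷ xs))) (map-upTo suc (length xs)) ⟨
  map (at (x ∷ xs)) (map suc (upTo (length xs))) ≡⟨ map-∘ (upTo (length xs)) ⟨
  map (at xs) (upTo (length xs))                 ≡⟨ map-at-upTo xs ⟩
  xs                                             ∎)

data Aligned : List ℕ → List (List ℕ) → Set where
  nil : Aligned [] []
  cons : ∀ p ρ {π ρs} → Aligned π ρs → Aligned (p ∷ π) (ρ ∷ ρs)

aligned : ∀ π (ρs : List (List ℕ)) → length ρs ≡ length π → Aligned π ρs
aligned [] [] _ = nil
aligned (p ∷ π) (ρ ∷ ρs) e = cons p ρ (aligned π ρs (suc-injective e))
aligned [] (_ ∷ _) ()
aligned (_ ∷ _) [] ()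

shiftedBlocks : (ℕ → ℕ) → List ℕ → List (List ℕ) → List (List ℕ)
shiftedBlocks c π ρs = zipWith (λ p ρ → map (c p +_) ρ) π ρs

place : (ℕ → ℕ) → List ℕ → List (List ℕ) → List ℕ
place c π ρs = concat (shiftedBlocks c π ρs)

place-cong : ∀ c c' → (∀ v → c v ≡ c' v) → ∀ π (ρs : List (List ℕ)) → place c π ρs ≡ place c' π ρs
place-cong c c' c≗c' [] ρs = refl
place-cong c c' c≗c' (p ∷ π) [] = refl
place-cong c c' c≗c' (p ∷ π) (ρ ∷ ρs) =
  cong₂ _++_ (cong (λ z → map (z +_) ρ) (c≗c' p)) (place-cong c c' c≗c' π ρs)

length-concat : ∀ (bs : List (List ℕ)) → length (concat bs) ≡ sum (map length bs)
length-concat [] = refl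
length-concat (b ∷ bs) = trans (length-++ b) (cong (length b +_) (length-concat bs))

length-shiftedBlocks : ∀ c {π ρs} → Aligned π ρs → map length (shiftedBlocks c π ρs) ≡ map length ρs
length-shiftedBlocks c nil = refl
length-shiftedBlocks c (cons p ρ r) = cong₂ _∷_ (length-map (c p +_) ρ) (length-shiftedBlocks c r)

length-place : ∀ c {π ρs} → Aligned π ρs → length (place c π ρs) ≡ sum (map length ρs)
length-place c {π} {ρs} r = trans (length-concat (shiftedBlocks c π ρs)) (cong sum (length-shiftedBlocks c r))

-- Generalized substitution is ordinary substitution where empty blocks are
-- allowed: dropping the empty blocks, together with the corresponding entries
-- of π, and standardising what is left of π changes no offset.

keptEntries : List ℕ → List (List ℕ) → List ℕ
keptEntries (p ∷ π) ([] ∷ ρs) = keptEntries π ρs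
keptEntries (p ∷ π) ((_ ∷ _) ∷ ρs) = p ∷ keptEntries π ρs
keptEntries _ _ = []

nonEmptyIdx-suc : ∀ k ρs → nonEmptyIdx (suc k) ρs ≡ map suc (nonEmptyIdx k ρs)
nonEmptyIdx-suc k [] = refl
nonEmptyIdx-suc k ([] ∷ ρs) = nonEmptyIdx-suc (suc k) ρs
nonEmptyIdx-suc k ((_ ∷ _) ∷ ρs) = cong (suc k ∷_) (nonEmptyIdx-suc (suc k) ρs)

at-nonEmptyIdx : ∀ {π ρs} → Aligned π ρs → map (at π) (nonEmptyIdx 0 ρs) ≡ keptEntries π ρs
at-nonEmptyIdx nil = refl
at-nonEmptyIdx (cons p [] {ρs = ρs} r) rewrite nonEmptyIdx-suc 0 ρs =
  trans (sym (map-∘ (nonEmptyIdx 0 ρs))) (at-nonEmptyIdx r)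
at-nonEmptyIdx (cons p (_ ∷ _) {ρs = ρs} r) rewrite nonEmptyIdx-suc 0 ρs =
  cong (p ∷_) (trans (sym (map-∘ (nonEmptyIdx 0 ρs))) (at-nonEmptyIdx r))

subst-std : ∀ π ρs → subst (std π) ρs ≡ subst π ρs
subst-std π ρs = place-relabel π ρs π⊆π
  where
  f : ℕ → ℕ
  f v = rank v π
  π⊆π : All (_∈ π) π
  π⊆π = All.tabulate (λ v∈π → v∈π)
  offset-relabel : ∀ {v} → v ∈ π → ∀ π₁ (ρs₁ : List (List ℕ)) → All (_∈ π) π₁ →
    offset (f v) (map f π₁) ρs₁ ≡ offset v π₁ ρs₁
  offset-relabel v∈π [] ρs₁ _ = refl
  offset-relabel v∈π (p ∷ π₁) [] _ = refl
  offset-relabel v∈π (p ∷ π₁) (ρ ∷ ρs₁) (p∈π ∷ π₁⊆π) =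
    cong₂ _+_ (cong (λ b → if b then length ρ else 0) (rank-<ᵇ π p∈π v∈π)) (offset-relabel v∈π π₁ ρs₁ π₁⊆π)
  place-relabel : ∀ π₁ ρs₁ → All (_∈ π) π₁ →
    place (λ p → offset p (map f π) ρs) (map f π₁) ρs₁ ≡ place (λ p → offset p π ρs) π₁ ρs₁
  place-relabel [] ρs₁ _ = refl
  place-relabel (p ∷ π₁) [] _ = refl
  place-relabel (p ∷ π₁) (ρ ∷ ρs₁) (p∈π ∷ π₁⊆π) =
    cong₂ _++_ (cong (λ z → map (z +_) ρ) (offset-relabel p∈π π ρs π⊆π)) (place-relabel π₁ ρs₁ π₁⊆π)

offset-dropEmpty : ∀ {π ρs} → Aligned π ρs → ∀ v → offset v (keptEntries π ρs) (dropEmpty ρs) ≡ offset v π ρs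
offset-dropEmpty nil v = refl
offset-dropEmpty (cons p [] r) v with p <ᵇ v
... | true = offset-dropEmpty r v
... | false = offset-dropEmpty r v
offset-dropEmpty (cons p (x ∷ xs) r) v = cong ((if p <ᵇ v then suc (length xs) else 0) +_) (offset-dropEmpty r v)

place-dropEmpty : ∀ c {π ρs} → Aligned π ρs → place c (keptEntries π ρs) (dropEmpty ρs) ≡ place c π ρs
place-dropEmpty c nil = refl
place-dropEmpty c (cons p [] r) = place-dropEmpty c r
place-dropEmpty c (cons p (x ∷ xs) r) = cong (map (c p +_) (x ∷ xs) ++_) (place-dropEmpty c r)

subst-dropEmpty : ∀ {π ρs} → Aligned π ρs → subst (keptEntries π ρs) (dropEmpty ρs) ≡ subst π ρs
subst-dropEmpty {π} {ρs} r = trans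
  (place-cong _ (λ p → offset p π ρs) (offset-dropEmpty r) (keptEntries π ρs) (dropEmpty ρs))
  (place-dropEmpty _ r)

gsubst≡subst : ∀ {π ρs} → Aligned π ρs → gsubst π ρs ≡ subst π ρs
gsubst≡subst {π} {ρs} r = begin
  subst (std (map (at π) (nonEmptyIdx 0 ρs))) (dropEmpty ρs) ≡⟨ cong (λ π' → subst (std π') (dropEmpty ρs)) (at-nonEmptyIdx r) ⟩
  subst (std (keptEntries π ρs)) (dropEmpty ρs)              ≡⟨ subst-std (keptEntries π ρs) (dropEmpty ρs) ⟩
  subst (keptEntries π ρs) (dropEmpty ρs)                    ≡⟨ subst-dropEmpty r ⟩
  subst π ρs                                                 ∎

-- The words read off the blocks of a substitution through an occurrence.  A
-- block records the entry `key` of π it replaces, the `size` of the inserted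
-- permutation, and the `word` of values of that permutation that were read.
record Block : Set where
  constructor block
  field
    key : ℕ
    size : ℕ
    word : List ℕ
open Block

sizeBelow : List Block → ℕ → ℕ
sizeBelow [] v = 0
sizeBelow (block q n w ∷ E) v = (if q <ᵇ v then n else 0) + sizeBelow E v

wordsBelow : List Block → ℕ → ℕ
wordsBelow [] v = 0
wordsBelow (block q n w ∷ E) v = (if q <ᵇ v then length w else 0) + wordsBelow E v

layout : (ℕ → ℕ) → List Block → List ℕ
layout c E = place c (map key E) (map word E)

standardise : List Block → List Block
standardise = map (λ b → block (key b) (size b) (std (word b)))

WordsFit : List Block → Set
WordsFit = All (λ b → All (_< size b) (word b))

if-mono : ∀ r m {a b} → a ≤ b → (if r <ᵇ a then m else 0) ≤ (if r <ᵇ b then m else 0)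
if-mono r m {a} {b} a≤b with r <ᵇ a in r<ᵇa
... | true rewrite <ᵇ-true (<-≤-trans (<ᵇ-true⁻ r a r<ᵇa) a≤b) = ≤-refl
... | false = z≤n

sizeBelow-mono : ∀ E {a b} → a ≤ b → sizeBelow E a ≤ sizeBelow E b
sizeBelow-mono [] _ = z≤n
sizeBelow-mono (block r m u ∷ E) a≤b = +-mono-≤ (if-mono r m a≤b) (sizeBelow-mono E a≤b)

sizeBelow-suc : ∀ {E q n w} → block q n w ∈ E → sizeBelow E q + n ≤ sizeBelow E (suc q)
sizeBelow-suc {block q n w ∷ E} (here refl) rewrite <ᵇ-false (≤-refl {q}) | <ᵇ-true (n<1+n q) =
  ≤-trans (≤-reflexive (+-comm (sizeBelow E q) n)) (+-monoʳ-≤ n (sizeBelow-mono E (n≤1+n q)))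
sizeBelow-suc {block r m u ∷ E} {q} {n} (there b∈E) =
  ≤-trans (≤-reflexive (+-assoc (if r <ᵇ q then m else 0) (sizeBelow E q) n))
          (+-mono-≤ (if-mono r m (n≤1+n q)) (sizeBelow-suc b∈E))

sizeBelow-gap : ∀ {E q n w p} → block q n w ∈ E → q < p → sizeBelow E q + n ≤ sizeBelow E p
sizeBelow-gap {E} b∈E q<p = ≤-trans (sizeBelow-suc b∈E) (sizeBelow-mono E q<p)

shift-below : ∀ c n w y → All (_< n) w → c + n ≤ y → All (_< y) (map (c +_) w)
shift-below c n [] y [] _ = []
shift-below c n (v ∷ w) y (v<n ∷ w<n) c+n≤y = <-≤-trans (+-monoʳ-< c v<n) c+n≤y ∷ shift-below c n w y w<n c+n≤y

shift-above : ∀ c w y → y ≤ c → All (y ≤_) (map (c +_) w)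
shift-above c [] y _ = []
shift-above c (v ∷ w) y y≤c = ≤-trans y≤c (m≤m+n c v) ∷ shift-above c w y y≤c

-- The number of entries of a block b below the value sizeBelow p + x, where x
-- is a value of the block of key p: all of b if its key is smaller, none if
-- its key is larger, and rank x w if b is the block of key p itself.
contribution : ℕ → ℕ → Block → ℕ
contribution p x (block q n w) = if q <ᵇ p then length w else (if p <ᵇ q then 0 else rank x w)

contributions : ℕ → ℕ → List Block → ℕ
contributions p x [] = 0
contributions p x (b ∷ E) = contribution p x b + contributions p x E

module _ (E₀ : List Block) (fit : WordsFit E₀) {p n w} (b∈E₀ : block p n w ∈ E₀) (x : ℕ) (x<n : x < n) where

  rank-in-block : ∀ {b} → b ∈ E₀ → rank (sizeBelow E₀ p + x) (map (sizeBelow E₀ (key b) +_) (word b)) ≡ contribution p x b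
  rank-in-block {block q m u} c∈E₀ with q <ᵇ p in q<ᵇp
  ... | true = trans (rank-above _ _ (shift-below (sizeBelow E₀ q) m u _ (All.lookup fit c∈E₀)
                       (≤-trans (sizeBelow-gap c∈E₀ (<ᵇ-true⁻ q p q<ᵇp)) (m≤m+n (sizeBelow E₀ p) x))))
                     (length-map _ u)
  ... | false with p <ᵇ q in p<ᵇq
  ...   | true = rank-below _ _ (shift-above (sizeBelow E₀ q) u _
                   (≤-trans (+-monoʳ-≤ (sizeBelow E₀ p) (<⇒≤ x<n)) (sizeBelow-gap b∈E₀ (<ᵇ-true⁻ p q p<ᵇq))))
  ...   | false rewrite ≤-antisym (<ᵇ-false⁻ q p q<ᵇp) (<ᵇ-false⁻ p q p<ᵇq) = rank-shift (sizeBelow E₀ q) x u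

  rank-in-layout : ∀ E → All (_∈ E₀) E → rank (sizeBelow E₀ p + x) (layout (sizeBelow E₀) E) ≡ contributions p x E
  rank-in-layout [] [] = refl
  rank-in-layout (c ∷ E) (c∈E₀ ∷ E⊆E₀) =
    trans (rank-++ _ (map (sizeBelow E₀ (key c) +_) (word c)) (layout (sizeBelow E₀) E))
          (cong₂ _+_ (rank-in-block c∈E₀) (rank-in-layout E E⊆E₀))

contribution-other : ∀ p x q n w → q ≢ p → contribution p x (block q n w) ≡ (if q <ᵇ p then length w else 0)
contribution-other p x q n w q≢p with q <ᵇ p in q<ᵇp
... | true = refl
... | false with p <ᵇ q in p<ᵇq
...   | true = refl
...   | false = ⊥-elim (q≢p (≤-antisym (<ᵇ-false⁻ p q p<ᵇq) (<ᵇ-false⁻ q p q<ᵇp)))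

contributions-others : ∀ p x E → All (λ b → key b ≢ p) E → contributions p x E ≡ wordsBelow E p
contributions-others p x [] [] = refl
contributions-others p x (block q n w ∷ E) (q≢p ∷ E≢p) =
  cong₂ _+_ (contribution-other p x q n w q≢p) (contributions-others p x E E≢p)

contributions-unique : ∀ E → Unique (map key E) → ∀ {p n w} → block p n w ∈ E → ∀ x →
  contributions p x E ≡ wordsBelow E p + rank x w
contributions-unique (block p n w ∷ E) (p∉E ∷ _) (here refl) x rewrite <ᵇ-false (≤-refl {p}) =
  trans (cong (rank x w +_) (contributions-others p x E (All.map (λ p≢q q≡p → p≢q (sym q≡p)) (All.map⁻ p∉E))))
        (+-comm (rank x w) (wordsBelow E p))
contributions-unique (block q m u ∷ E) (q∉E ∷ u-E) {p} {n} {w} (there b∈E) x =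
  trans (cong₂ _+_ (contribution-other p x q m u (All.lookup q∉E (∈-map⁺ key b∈E))) (contributions-unique E u-E b∈E x))
        (sym (+-assoc (if q <ᵇ p then length u else 0) (wordsBelow E p) (rank x w)))

-- Within the layout of all blocks, the value x of the block of key p has rank
-- wordsBelow p + rank x w: the layout is order-isomorphic to the layout of the
-- standardised words.
std-layout : ∀ E → WordsFit E → Unique (map key E) → std (layout (sizeBelow E) E) ≡ layout (wordsBelow E) (standardise E)
std-layout E fit u = ranks-of-sublayout E (All.tabulate (λ b∈E → b∈E))
  where
  ranks-of-sublayout : ∀ E' → All (_∈ E) E' →
    map (λ z → rank z (layout (sizeBelow E) E)) (layout (sizeBelow E) E') ≡ layout (wordsBelow E) (standardise E')
  ranks-of-sublayout [] [] = refl
  ranks-of-sublayout (block p n w ∷ E') (b∈E ∷ E'⊆E) =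
    trans (map-++ _ (map (sizeBelow E p +_) w) (layout (sizeBelow E) E'))
          (cong₂ _++_ block-ranks (ranks-of-sublayout E' E'⊆E))
    where
    block-ranks : map (λ z → rank z (layout (sizeBelow E) E)) (map (sizeBelow E p +_) w) ≡ map (wordsBelow E p +_) (std w)
    block-ranks = trans (sym (map-∘ w)) (trans
      (map-cong-local (All.map (λ {x} x<n → trans (rank-in-layout E fit b∈E x x<n E (All.tabulate (λ c∈E → c∈E)))
                                                  (contributions-unique E u b∈E x))
                               (All.lookup fit b∈E)))
      (map-∘ w))

-- An occurrence in a substitution π[σs] is described blockwise by index sets
-- Ks, Kᵢ in σᵢ; joinIdx gives the corresponding index set in π[σs].
joinIdx : List (List ℕ) → List (List ℕ) → List ℕ
joinIdx (s ∷ σs) (K ∷ Ks) = K ++ map (length s +_) (joinIdx σs Ks)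
joinIdx _ _ = []

patterns : List (List ℕ) → List (List ℕ) → List (List ℕ)
patterns = zipWith patt

Fits : List ℕ → List ℕ → Set
Fits s K = All (_< length s) K

toBlocks : List ℕ → List (List ℕ) → List (List ℕ) → List Block
toBlocks (p ∷ π) (s ∷ σs) (K ∷ Ks) = block p (length s) (map (at s) K) ∷ toBlocks π σs Ks
toBlocks _ _ _ = []

module _ {π σs Ks} (r : Aligned π σs) (fits : Pointwise Fits σs Ks) where
  private
    E : List Block
    E = toBlocks π σs Ks

  keys-toBlocks : map key E ≡ π
  keys-toBlocks = go r fits
    where
    go : ∀ {π σs Ks} → Aligned π σs → Pointwise Fits σs Ks → map key (toBlocks π σs Ks) ≡ π
    go nil [] = refl
    go (cons p s r) (_ ∷ fits) = cong (p ∷_) (go r fits)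

  sizeBelow-toBlocks : ∀ v → sizeBelow E v ≡ offset v π σs
  sizeBelow-toBlocks v = go r fits
    where
    go : ∀ {π σs Ks} → Aligned π σs → Pointwise Fits σs Ks → sizeBelow (toBlocks π σs Ks) v ≡ offset v π σs
    go nil [] = refl
    go (cons p s r) (_ ∷ fits) = cong ((if p <ᵇ v then length s else 0) +_) (go r fits)

  wordsBelow-toBlocks : ∀ v → wordsBelow E v ≡ offset v π (patterns σs Ks)
  wordsBelow-toBlocks v = go r fits
    where
    go : ∀ {π σs Ks} → Aligned π σs → Pointwise Fits σs Ks → wordsBelow (toBlocks π σs Ks) v ≡ offset v π (patterns σs Ks)
    go nil [] = refl
    go (cons p s r) (_∷_ {y = K} _ fits) =
      cong₂ _+_ (cong (λ l → if p <ᵇ v then l else 0) (sym (length-std (map (at s) K)))) (go r fits)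

  words-fit : All IsPerm σs → WordsFit E
  words-fit = go r fits
    where
    go : ∀ {π σs Ks} → Aligned π σs → Pointwise Fits σs Ks → All IsPerm σs → WordsFit (toBlocks π σs Ks)
    go nil [] [] = []
    go (cons p s r) (K<n ∷ fits) (s-perm ∷ perms) =
      All.map⁺ (All.map (λ {k} k<n → at-bounded k s-perm k<n) K<n) ∷ go r fits perms

  read-joinIdx : ∀ c → map (at (place c π σs)) (joinIdx σs Ks) ≡ layout c E
  read-joinIdx c = go r fits
    where
    go : ∀ {π σs Ks} → Aligned π σs → Pointwise Fits σs Ks →
      map (at (place c π σs)) (joinIdx σs Ks) ≡ layout c (toBlocks π σs Ks)
    go nil [] = refl
    go (cons p s {π} {σs} r) (_∷_ {y = K} {ys = Ks} K<n fits) =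
      trans (map-++ _ K (map (length s +_) (joinIdx σs Ks))) (cong₂ _++_ read-head read-tail)
      where
      b = map (c p +_) s
      rest = place c π σs
      read-head : map (at (b ++ rest)) K ≡ map (c p +_) (map (at s) K)
      read-head = trans
        (map-cong-local (All.map (λ {k} k<n → trans (at-++ˡ b rest k (≡-subst (k <_) (sym (length-map _ s)) k<n))
                                                    (at-map (c p +_) s k k<n)) K<n))
        (map-∘ K)
      read-tail : map (at (b ++ rest)) (map (length s +_) (joinIdx σs Ks)) ≡ layout c (toBlocks π σs Ks)
      read-tail = trans (sym (map-∘ (joinIdx σs Ks))) (trans
        (map-cong (λ k → trans (cong (λ l → at (b ++ rest) (l + k)) (sym (length-map (c p +_) s))) (at-++ʳ b rest k))
                  (joinIdx σs Ks))
        (go r fits))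

  place-patterns : ∀ c → place c π (patterns σs Ks) ≡ layout c (standardise E)
  place-patterns c = go r fits
    where
    go : ∀ {π σs Ks} → Aligned π σs → Pointwise Fits σs Ks → place c π (patterns σs Ks) ≡ layout c (standardise (toBlocks π σs Ks))
    go nil [] = refl
    go (cons p s r) (_∷_ {y = K} _ fits) = cong (map (c p +_) (patt s K) ++_) (go r fits)

  pattern-of-subst : Unique π → All IsPerm σs → patt (subst π σs) (joinIdx σs Ks) ≡ subst π (patterns σs Ks)
  pattern-of-subst u perms = begin
    std (map (at (subst π σs)) (joinIdx σs Ks))    ≡⟨ cong std (read-joinIdx (λ v → offset v π σs)) ⟩
    std (layout (λ v → offset v π σs) E)           ≡⟨ cong std (place-cong _ _ (λ v → sym (sizeBelow-toBlocks v)) (map key E) (map word E)) ⟩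
    std (layout (sizeBelow E) E)                   ≡⟨ std-layout E (words-fit perms) (≡-subst Unique (sym keys-toBlocks) u) ⟩
    layout (wordsBelow E) (standardise E)          ≡⟨ place-cong _ _ wordsBelow-toBlocks (map key (standardise E)) (map word (standardise E)) ⟩
    layout (λ v → offset v π (patterns σs Ks)) (standardise E) ≡⟨ place-patterns _ ⟨
    subst π (patterns σs Ks)                       ∎

IndexSet : ℕ → List ℕ → Set
IndexSet n K = AllPairs _<_ K × All (_< n) K

shift-down : ∀ n m I → All (n ≤_) I → IndexSet (n + m) I → IndexSet m (map (_∸ n) I) × map (n +_) (map (_∸ n) I) ≡ I
shift-down n m I n≤I (incr , bounded) =
  (AllPairs.map⁺ (still-increasing I n≤I incr) ,
   All.map⁺ (All.zipWith (λ (n≤i , i<n+m) → ∸-below n≤i i<n+m) (n≤I , bounded))) ,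
  trans (sym (map-∘ I)) (map-id-local (All.map m+[n∸m]≡n n≤I))
  where
  still-increasing : ∀ I → All (n ≤_) I → AllPairs _<_ I → AllPairs (λ i j → i ∸ n < j ∸ n) I
  still-increasing [] [] [] = []
  still-increasing (i ∷ I) (n≤i ∷ n≤I) (i<I ∷ incr) =
    All.zipWith (λ (_ , i<j) → ∸-monoˡ-< i<j n≤i) (n≤I , i<I) ∷ still-increasing I n≤I incr
  ∸-below : ∀ {i} → n ≤ i → i < n + m → i ∸ n < m
  ∸-below {i} n≤i i<n+m = +-cancelˡ-< n (i ∸ n) m (≡-subst (_< n + m) (sym (m+[n∸m]≡n n≤i)) i<n+m)

split-at : ∀ n m I → IndexSet (n + m) I →
  Σ (List ℕ) λ K → Σ (List ℕ) λ I' → IndexSet n K × IndexSet m I' × I ≡ K ++ map (n +_) I'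
split-at n m [] _ = [] , [] , ([] , []) , ([] , []) , refl
split-at n m (i ∷ I) (i<I ∷ incr , i<n+m ∷ bounded) with i <? n
... | yes i<n with split-at n m I (incr , bounded)
...   | K , I' , (incrK , K<n) , rest , refl =
        i ∷ K , I' , (All.++⁻ˡ K i<I ∷ incrK , i<n ∷ K<n) , rest , refl
split-at n m (i ∷ I) (i<I ∷ incr , i<n+m ∷ bounded) | no i≮n =
  [] , map (_∸ n) (i ∷ I) , ([] , []) , proj₁ shifted , sym (proj₂ shifted)
  where
  n≤i : n ≤ i
  n≤i = ≮⇒≥ i≮n
  shifted : IndexSet m (map (_∸ n) (i ∷ I)) × map (n +_) (map (_∸ n) (i ∷ I)) ≡ i ∷ I
  shifted = shift-down n m (i ∷ I) (n≤i ∷ All.map (λ i<j → ≤-trans n≤i (<⇒≤ i<j)) i<I) (i<I ∷ incr , i<n+m ∷ bounded)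

join-indexSets : ∀ {σs Ks} → Pointwise (λ s → IndexSet (length s)) σs Ks → IndexSet (sum (map length σs)) (joinIdx σs Ks)
join-indexSets [] = [] , []
join-indexSets {s ∷ σs} {K ∷ Ks} ((incrK , K<n) ∷ rest) with join-indexSets rest
... | incr , bounded =
  AllPairs.++⁺ incrK (AllPairs.map⁺ (AllPairs.map (+-monoʳ-< n) incr))
    (All.map (λ {k} k<n → All.map⁺ (All.tabulate (λ {j} _ → <-≤-trans k<n (m≤m+n n j)))) K<n) ,
  All.++⁺ (All.map (λ k<n → <-≤-trans k<n (m≤m+n n (sum (map length σs)))) K<n)
          (All.map⁺ (All.map (+-monoʳ-< n) bounded))
  where
  n = length s

split-blocks : ∀ σs I → IndexSet (sum (map length σs)) I →
  ∃ λ Ks → Pointwise (λ s → IndexSet (length s)) σs Ks × I ≡ joinIdx σs Ks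
split-blocks [] [] _ = [] , [] , refl
split-blocks [] (i ∷ I) (_ , () ∷ _)
split-blocks (s ∷ σs) I indexSet with split-at (length s) (sum (map length σs)) I indexSet
... | K , I' , K-ok , I'-ok , refl with split-blocks σs I' I'-ok
...   | Ks , Ks-ok , refl = K ∷ Ks , K-ok ∷ Ks-ok , refl

-- The canonical embedding of γ = π[ρs] in π: the i-th block of γ occupies a
-- run of consecutive indices, whose values are consecutive since ρᵢ is a
-- permutation; these runs are intervals (or empty) and recover the ρᵢ.

runs : ℕ → List ℕ → List (List ℕ)
runs s [] = []
runs s (l ∷ ls) = map (s +_) (upTo l) ∷ runs (s + l) ls

length-runs : ∀ s ls → length (runs s ls) ≡ length ls
length-runs s [] = refl
length-runs s (l ∷ ls) = cong suc (length-runs (s + l) ls)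

upTo-+ : ∀ a b → upTo (a + b) ≡ upTo a ++ map (a +_) (upTo b)
upTo-+ zero b = sym (map-id (upTo b))
upTo-+ (suc a) b = cong (0 ∷_) (begin
  applyUpTo suc (a + b)                                     ≡⟨ map-upTo suc (a + b) ⟨
  map suc (upTo (a + b))                                    ≡⟨ cong (map suc) (upTo-+ a b) ⟩
  map suc (upTo a ++ map (a +_) (upTo b))                   ≡⟨ map-++ suc (upTo a) _ ⟩
  map suc (upTo a) ++ map suc (map (a +_) (upTo b))         ≡⟨ cong₂ _++_ (map-upTo suc a) (sym (map-∘ (upTo b))) ⟩
  applyUpTo suc a ++ map (suc a +_) (upTo b)                ∎)

concat-runs : ∀ s ls → concat (runs s ls) ≡ map (s +_) (upTo (sum ls))
concat-runs s [] = refl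
concat-runs s (l ∷ ls) = begin
  map (s +_) (upTo l) ++ concat (runs (s + l) ls)             ≡⟨ cong (map (s +_) (upTo l) ++_) (concat-runs (s + l) ls) ⟩
  map (s +_) (upTo l) ++ map (s + l +_) (upTo (sum ls))       ≡⟨ cong (map (s +_) (upTo l) ++_) (trans (map-cong (+-assoc s l) (upTo (sum ls))) (map-∘ (upTo (sum ls)))) ⟩
  map (s +_) (upTo l) ++ map (s +_) (map (l +_) (upTo (sum ls))) ≡⟨ map-++ (s +_) (upTo l) _ ⟨
  map (s +_) (upTo l ++ map (l +_) (upTo (sum ls)))           ≡⟨ cong (map (s +_)) (upTo-+ l (sum ls)) ⟨
  map (s +_) (upTo (l + sum ls))                              ∎

read-block : ∀ pre b rest → map (at (pre ++ (b ++ rest))) (map (length pre +_) (upTo (length b))) ≡ b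
read-block pre b rest = begin
  map (at (pre ++ (b ++ rest))) (map (length pre +_) (upTo (length b))) ≡⟨ map-∘ (upTo (length b)) ⟨
  map (λ k → at (pre ++ (b ++ rest)) (length pre + k)) (upTo (length b)) ≡⟨ map-cong (at-++ʳ pre (b ++ rest)) (upTo (length b)) ⟩
  map (at (b ++ rest)) (upTo (length b))                                 ≡⟨ map-cong-local (All.map (λ {k} → at-++ˡ b rest k) (All-upTo (length b))) ⟩
  map (at b) (upTo (length b))                                           ≡⟨ map-at-upTo b ⟩
  b                                                                      ∎

read-runs : ∀ pre bs → map (map (at (pre ++ concat bs))) (runs (length pre) (map length bs)) ≡ bs
read-runs pre [] = refl
read-runs pre (b ∷ bs) = cong₂ _∷_ (read-block pre b (concat bs)) (begin
  map (map (at (pre ++ (b ++ concat bs)))) (runs (length pre + length b) (map length bs))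
    ≡⟨ cong₂ (λ γ s → map (map (at γ)) (runs s (map length bs))) (sym (++-assoc pre b (concat bs))) (sym (length-++ pre)) ⟩
  map (map (at ((pre ++ b) ++ concat bs))) (runs (length (pre ++ b)) (map length bs))
    ≡⟨ read-runs (pre ++ b) bs ⟩
  bs ∎)

Translated : List ℕ → Set
Translated b = ∃ λ m → b ↭ map (m +_) (upTo (length b))

-- The runs of translated blocks are intervals (or empty).  The list γ and the
-- start s are generalised so that the recursive call can move a block into pre.
runs-intervals : ∀ pre bs {γ s} → γ ≡ pre ++ concat bs → s ≡ length pre → All Translated bs →
  All (λ I → I ≡ [] ⊎ IsInterval γ I) (runs s (map length bs))
runs-intervals pre [] _ _ _ = []
runs-intervals pre ([] ∷ bs) refl refl (_ ∷ translated) =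
  inj₁ refl ∷ runs-intervals pre bs refl (+-identityʳ (length pre)) translated
runs-intervals pre ((x ∷ xs) ∷ bs) refl refl ((m , b↭) ∷ translated) =
  inj₂ (length pre , length xs , refl , fits , m , ↭.↭-trans (↭.↭-reflexive (read-block pre (x ∷ xs) (concat bs))) b↭)
  ∷ runs-intervals (pre ++ (x ∷ xs)) bs (sym (++-assoc pre (x ∷ xs) (concat bs))) (sym (length-++ pre)) translated
  where
  fits : length pre + suc (length xs) ≤ length (pre ++ ((x ∷ xs) ++ concat bs))
  fits rewrite length-++ pre {(x ∷ xs) ++ concat bs} | length-++ (x ∷ xs) {concat bs} =
    +-monoʳ-≤ (length pre) (m≤m+n (suc (length xs)) (length (concat bs)))

translated-blocks : ∀ c {π ρs} → Aligned π ρs → All IsPerm ρs → All Translated (shiftedBlocks c π ρs)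
translated-blocks c nil [] = []
translated-blocks c (cons p ρ r) (ρ-perm ∷ perms) =
  (c p , ≡-subst (λ l → map (c p +_) ρ ↭ map (c p +_) (upTo l)) (sym (length-map (c p +_) ρ)) (↭.map⁺ (c p +_) ρ-perm))
  ∷ translated-blocks c r perms

std-shiftedBlocks : ∀ c {π ρs} → Aligned π ρs → All IsPerm ρs → map std (shiftedBlocks c π ρs) ≡ ρs
std-shiftedBlocks c nil [] = refl
std-shiftedBlocks c (cons p ρ r) (ρ-perm ∷ perms) =
  cong₂ _∷_ (trans (std-shift (c p) ρ) (std-perm ρ-perm)) (std-shiftedBlocks c r perms)

count-shiftedBlocks : ∀ c {π ρs} → Aligned π ρs → length (shiftedBlocks c π ρs) ≡ length π
count-shiftedBlocks c nil = refl
count-shiftedBlocks c (cons p ρ r) = cong suc (count-shiftedBlocks c r)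

canonical-embedding : ∀ {π ρs} → Aligned π ρs → All IsPerm ρs →
  ∃ λ α → IsEmbedding (subst π ρs) π α × map (patt (subst π ρs)) α ≡ ρs
canonical-embedding {π} {ρs} r perms = α , (count-α , intervals , covers , recovers) , patterns-α
  where
  bs : List (List ℕ)
  bs = shiftedBlocks (λ p → offset p π ρs) π ρs
  γ : List ℕ
  γ = concat bs
  α : List (List ℕ)
  α = runs 0 (map length bs)
  patterns-α : map (patt γ) α ≡ ρs
  patterns-α = begin
    map (λ I → std (map (at γ) I)) α ≡⟨ map-∘ α ⟩
    map std (map (map (at γ)) α)      ≡⟨ cong (map std) (read-runs [] bs) ⟩
    map std bs                        ≡⟨ std-shiftedBlocks _ r perms ⟩
    ρs                                ∎
  count-α : length α ≡ length π
  count-α = trans (length-runs 0 (map length bs)) (trans (length-map length bs) (count-shiftedBlocks _ r))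
  intervals : All (λ I → I ≡ [] ⊎ IsInterval γ I) α
  intervals = runs-intervals [] bs refl refl (translated-blocks _ r perms)
  covers : concat α ≡ upTo (length γ)
  covers = trans (concat-runs 0 (map length bs)) (trans (map-id _) (cong upTo (sym (length-concat bs))))
  recovers : gsubst π (map (patt γ) α) ≡ γ
  recovers = trans (cong (gsubst π) patterns-α) (gsubst≡subst r)

PermValued : PSet → Set
PermValued D = ∀ σ → D σ → IsPerm σ

members-perms : ∀ {Ds σs} → All PermValued Ds → Members Ds σs → All IsPerm σs × length σs ≡ length Ds
members-perms {[]} {[]} [] _ = [] , refl
members-perms {D ∷ Ds} {σ ∷ σs} (D-perm ∷ Ds-perm) (σ∈D , σs∈Ds) with members-perms Ds-perm σs∈Ds
... | perms , count = D-perm σ σ∈D ∷ perms , cong suc count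
members-perms {[]} {_ ∷ _} _ ()
members-perms {_ ∷ _} {[]} _ ()

Occurrences : List (List ℕ) → List (List ℕ) → Set
Occurrences = Pointwise (λ s → IndexSet (length s))

restricted-members : ∀ Ds ρs σs → length ρs ≡ length Ds → Members (zipWith restrict Ds ρs) σs →
  Members Ds σs × ∃ λ Ks → Occurrences σs Ks × patterns σs Ks ≡ ρs
restricted-members [] [] [] _ _ = tt , [] , [] , refl
restricted-members (D ∷ Ds) (ρ ∷ ρs) (σ ∷ σs) count ((σ∈D , (K , incr , bounded , refl)) , rest)
  with restricted-members Ds ρs σs (suc-injective count) rest
... | σs∈Ds , Ks , occs , refl = (σ∈D , σs∈Ds) , K ∷ Ks , (Linked⇒AllPairs <-trans incr , bounded) ∷ occs , refl
restricted-members [] (_ ∷ _) _ () _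
restricted-members (_ ∷ _) [] _ () _
restricted-members [] [] (_ ∷ _) _ ()
restricted-members (_ ∷ _) (_ ∷ _) [] _ ()

members-restricted : ∀ {Ds σs Ks} → Members Ds σs → Occurrences σs Ks → Members (zipWith restrict Ds (patterns σs Ks)) σs
members-restricted {[]} {[]} {[]} tt [] = tt
members-restricted {D ∷ Ds} {σ ∷ σs} {K ∷ Ks} (σ∈D , σs∈Ds) ((incr , bounded) ∷ occs) =
  (σ∈D , (K , AllPairs⇒Linked incr , bounded , refl)) , members-restricted σs∈Ds occs
members-restricted {[]} {_ ∷ _} ()
members-restricted {_ ∷ _} {[]} ()

patterns-perms : ∀ {σs Ks} → Occurrences σs Ks → All IsPerm σs → All IsPerm (patterns σs Ks)
patterns-perms [] [] = []
patterns-perms {s ∷ σs} {K ∷ Ks} ((incr , bounded) ∷ occs) (s-perm ∷ perms) =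
  std-unique (map (at s) K) (unique-at s K (perm-unique s-perm) incr bounded) ∷ patterns-perms occs perms

length-patterns : ∀ {σs Ks} → Occurrences σs Ks → length (patterns σs Ks) ≡ length σs
length-patterns [] = refl
length-patterns (_ ∷ occs) = cong suc (length-patterns occs)

fits : ∀ {σs Ks} → Occurrences σs Ks → Pointwise Fits σs Ks
fits = PW.map proj₂

module _ (π : List ℕ) (Ds : List PSet) (π-unique : Unique π) (count-Ds : length Ds ≡ length π)
         (Ds-perm : All PermValued Ds) where

  occurrence⇒embedding : ∀ γ τ → restrict (InSubstSet π Ds) γ τ →
    ∃ λ α → IsEmbedding γ π α × InSubstSet π (zipWith restrict Ds (map (patt γ) α)) τ
  occurrence⇒embedding .(patt (subst π σs) I) .(subst π σs) ((σs , σs∈Ds , refl) , (I , incr , bounded , refl))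
    with members-perms Ds-perm σs∈Ds
  ... | perms , count-σs
    with split-blocks σs I (Linked⇒AllPairs <-trans incr ,
                            ≡-subst (λ l → All (_< l) I) (length-place _ (aligned π σs (trans count-σs count-Ds))) bounded)
  ... | Ks , occs , refl
    rewrite pattern-of-subst (aligned π σs (trans count-σs count-Ds)) (fits occs) π-unique perms
    with canonical-embedding (aligned π (patterns σs Ks) (trans (length-patterns occs) (trans count-σs count-Ds)))
                             (patterns-perms occs perms)
  ... | α , embedding , patterns-α =
    α , embedding , σs , ≡-subst (λ ρs → Members (zipWith restrict Ds ρs) σs) (sym patterns-α)
                                 (members-restricted σs∈Ds occs) , refl

  embedding⇒occurrence : ∀ γ τ → (∃ λ α → IsEmbedding γ π α × InSubstSet π (zipWith restrict Ds (map (patt γ) α)) τ) →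
    restrict (InSubstSet π Ds) γ τ
  embedding⇒occurrence γ .(subst π σs) (α , (count-α , _ , _ , recovers) , (σs , σs∈restricted , refl))
    with restricted-members Ds (map (patt γ) α) σs (trans (length-map (patt γ) α) (trans count-α (sym count-Ds))) σs∈restricted
  ... | σs∈Ds , Ks , occs , patterns≡ with members-perms Ds-perm σs∈Ds
  ... | perms , count-σs with join-indexSets occs
  ... | incr , bounded = (σs , σs∈Ds , refl) , joinIdx σs Ks , AllPairs⇒Linked incr , bounded' , occurs
    where
    r : Aligned π σs
    r = aligned π σs (trans count-σs count-Ds)
    bounded' : All (_< length (subst π σs)) (joinIdx σs Ks)
    bounded' = ≡-subst (λ l → All (_< l) (joinIdx σs Ks)) (sym (length-place _ r)) bounded
    occurs : patt (subst π σs) (joinIdx σs Ks) ≡ γ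
    occurs = begin
      patt (subst π σs) (joinIdx σs Ks)  ≡⟨ pattern-of-subst r (fits occs) π-unique perms ⟩
      subst π (patterns σs Ks)           ≡⟨ cong (subst π) patterns≡ ⟩
      subst π (map (patt γ) α)           ≡⟨ gsubst≡subst (aligned π (map (patt γ) α) (trans (length-map (patt γ) α) count-α)) ⟨
      gsubst π (map (patt γ) α)          ≡⟨ recovers ⟩
      γ                                  ∎

proposition6p6 : (π : List ℕ) (Ds : List PSet) (γ : List ℕ) →
    IsPerm π → length Ds ≡ length π → All (λ D → ∀ σ → D σ → IsPerm σ) Ds → IsPerm γ →
    ∀ (τ : List ℕ) →
      restrict (InSubstSet π Ds) γ τ
        ⇔ (∃ λ (α : List (List ℕ)) → IsEmbedding γ π α ×
             InSubstSet π (zipWith restrict Ds (map (patt γ) α)) τ)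
proposition6p6 π Ds γ π-perm count-Ds Ds-perm _ τ =
  mk⇔ (occurrence⇒embedding π Ds (perm-unique π-perm) count-Ds Ds-perm γ τ)
      (embedding⇒occurrence π Ds (perm-unique π-perm) count-Ds Ds-perm γ τ)
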